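{- For any nontrivial irreducible type $\tau$ whose block decomposition has $b\ge 2$ blocks and every positive integer $n$ (at least the width of $\tau$), there is a graph homomorphism $\phi\colon G(n,\tau)\to G_{b-1}(n)$.
   Context: For finite sets $X,Y\subseteq\mathbb{Q}$ with $X\cup Y=\{z_1<\dots<z_\ell\}$, the order type $\tau(X,Y)$ is the sequence $(\tau_1,\dots,\tau_\ell)$ with $\tau_i=1$ if $z_i\in X\setminus Y$, $2$ if $z_i\in Y\setminus X$, $3$ if $z_i\in X\cap Y$. A type of width $k$ is the order type of a pair $(X,Y)$ with $|X|=|Y|=k$. A type is trivial if all entries equal $3$. A nonempty type is irreducible if it is not the concatenation of two nonempty types; a nontrivial irreducible type is primary if it starts with $1$, secondary if it starts with $2$. $\mathbf{1}(B)$ (resp. $\mathbf{2}(B)$) is the number of entries of a sequence $B$ equal to $1$ or $3$ (resp. $2$ or $3$). Block decomposition of a primary irreducible type $\tau$: $B_1$ is the maximal initial run of ones; once $B_i$ is constructed, $B_{i+1}$ consists of the next consecutive entries with $\mathbf{2}(B_{i+1})=\mathbf{1}(B_i)$ and, subject to this, as long as possible; stop when all entries are placed, giving $\tau=B_1\cdots B_b$. For a secondary irreducible type, interchange ones and twos, decompose, and interchange back. The type-graph $G(n,\tau)$ for a nontrivial type of width $k$ has vertex set $\binom{[n]}{k}$, with $X,Y$ adjacent iff $\tau(X,Y)=\tau$ or $\tau(Y,X)=\tau$. For positive integers $b,n$, let $V_b(n)$ be the set of tuples $(x_1,\dots,x_{2b-1})$ of integers with $1\le x_1\le x_2\le\dots\le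 x_{2b-1}\le n$ and $x_1<x_3<\dots<x_{2b-1}$; $G_b(n)$ is the graph on $V_b(n)$ in which $\{\mathbf{x},\mathbf{y}\}$ is an edge iff one can write $\mathbf{x}=(x_1,\dots,x_{2b-1})$, $\mathbf{y}=(y_1,\dots,y_{2b-1})$ (in some order of the two vertices) with (i) $x_1<y_1\le x_3<y_3\le\dots\le x_{2b-1}<y_{2b-1}$ and (ii) $x_{j+1}\le y_j$ for all $j\in[2b-2]$. -}

module Defs where

open import Data.Nat using (ℕ; zero; suc; _+_; _*_; _∸_; _≤_; _<_)
open import Data.Bool using (Bool; true; false)
open import Data.List using (List; []; _∷_; _++_; map; length)
open import Data.List.Relation.Unary.All using (All)
open import Data.Vec using (Vec; []; _∷_)
open import Data.Fin.Subset using (Subset; ∣_∣)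
open import Data.Product using (Σ; ∃; ∃-syntax; _×_)
open import Data.Sum using (_⊎_)
open import Relation.Binary.PropositionalEquality using (_≡_; _≢_)
open import Relation.Nullary using (¬_)

data Entry : Set where
  one two three : Entry

Type : Set
Type = List Entry

ones : Type → ℕ
ones []            = 0
ones (one   ∷ xs)  = suc (ones xs)
ones (two   ∷ xs)  = ones xs
ones (three ∷ xs)  = suc (ones xs)

twos : Type → ℕ
twos []            = 0
twos (one   ∷ xs)  = twos xs
twos (two   ∷ xs)  = suc (twos xs)
twos (three ∷ xs)  = suc (twos xs)

orderType : ∀ {n} → Subset n → Subset n → Type
orderType []             []             = []
orderType (true  ∷ xs)   (true  ∷ ys)   = three ∷ orderType xs ys
orderType (true  ∷ xs)   (false ∷ ys)   = one   ∷ orderType xs ys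
orderType (false ∷ xs)   (true  ∷ ys)   = two   ∷ orderType xs ys
orderType (false ∷ xs)   (false ∷ ys)   = orderType xs ys

-- τ is a type of width k: it is the order type of a pair (X,Y) with |X| = |Y| = k,
-- i.e. (every sequence being realisable by X,Y ⊆ ℚ) 𝟏(τ) = 𝟐(τ) = k.
IsTypeOfWidth : ℕ → Type → Set
IsTypeOfWidth k τ = (ones τ ≡ k) × (twos τ ≡ k)

IsType : Type → Set
IsType τ = ∃[ k ] IsTypeOfWidth k τ

Trivial : Type → Set
Trivial τ = All (_≡ three) τ

Nontrivial : Type → Set
Nontrivial τ = ¬ Trivial τ

Irreducible : Type → Set
Irreducible τ =
  IsType τ × (τ ≢ []) ×
  ¬ (Σ Type λ σ → Σ Type λ ρ →
       IsType σ × IsType ρ × (σ ≢ []) × (ρ ≢ []) × (τ ≡ σ ++ ρ))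

StartsWith : Entry → Type → Set
StartsWith e τ = Σ Type λ rest → τ ≡ e ∷ rest

Primary : Type → Set
Primary τ = Nontrivial τ × Irreducible τ × StartsWith one τ

Secondary : Type → Set
Secondary τ = Nontrivial τ × Irreducible τ × StartsWith two τ

-- BlocksAfter prev rest Bs : the remaining entries `rest` are split into the
-- blocks Bs by the rule: the next block B consists of the next consecutive
-- entries with 𝟐(B) = 𝟏(prev), and subject to this as long as possible;
-- stop when all entries are placed.
data BlocksAfter (prev : Type) : Type → List Type → Set where
  done : BlocksAfter prev [] []
  next : ∀ {rest rest′ Bs} (B : Type) →
         B ≢ [] →
         rest ≡ B ++ rest′ →
         twos B ≡ ones prev →
         (∀ P Q → P ≢ [] → rest′ ≡ P ++ Q → twos (B ++ P) ≢ ones prev) →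
         BlocksAfter B rest′ Bs →
         BlocksAfter prev rest (B ∷ Bs)

PrimaryBlockDecomposition : Type → List Type → Set
PrimaryBlockDecomposition τ []        = Data.Empty.⊥
  where import Data.Empty
PrimaryBlockDecomposition τ (B₁ ∷ Bs) =
  Σ Type λ rest →
    (B₁ ≢ []) × All (_≡ one) B₁ × (τ ≡ B₁ ++ rest) ×
    ¬ StartsWith one rest ×
    BlocksAfter B₁ rest Bs

swapE : Entry → Entry
swapE one   = two
swapE two   = one
swapE three = three

BlockDecomposition : Type → List Type → Set
BlockDecomposition τ Bs =
  (Primary τ × PrimaryBlockDecomposition τ Bs) ⊎
  (Secondary τ × PrimaryBlockDecomposition (map swapE τ) (map (map swapE) Bs))

record Graph : Set₁ where
  field
    V   : Set
    Adj : V → V → Set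

open Graph public

Hom : Graph → Graph → Set
Hom G H = Σ (V G → V H) λ φ → ∀ u v → Adj G u v → Adj H (φ u) (φ v)

typeGraph : (n k : ℕ) → Type → Graph
typeGraph n k τ = record
  { V   = Σ (Subset n) (λ X → ∣ X ∣ ≡ k)
  ; Adj = λ X Y → (orderType (Data.Product.proj₁ X) (Data.Product.proj₁ Y) ≡ τ)
                ⊎ (orderType (Data.Product.proj₁ Y) (Data.Product.proj₁ X) ≡ τ)
  }
  where import Data.Product

-- 1-indexed access x_j to a vector (0 outside the range; only used in range)
at : ∀ {m} → Vec ℕ m → ℕ → ℕ
at []       _             = 0
at (x ∷ xs) zero          = 0
at (x ∷ xs) (suc zero)    = x
at (x ∷ xs) (suc (suc j)) = at xs (suc j)

len : ℕ → ℕ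
len b = 2 * b ∸ 1

InV : (b n : ℕ) → Vec ℕ (len b) → Set
InV b n x =
  (1 ≤ at x 1) ×
  (at x (len b) ≤ n) ×
  (∀ j → 1 ≤ j → j < len b → at x j ≤ at x (suc j)) ×
  (∀ i → 1 ≤ i → i < b → at x (2 * i ∸ 1) < at x (2 * i + 1))

EdgeDir : (b : ℕ) → Vec ℕ (len b) → Vec ℕ (len b) → Set
EdgeDir b x y =
  (∀ i → 1 ≤ i → i ≤ b → at x (2 * i ∸ 1) < at y (2 * i ∸ 1)) ×
  (∀ i → 1 ≤ i → i < b → at y (2 * i ∸ 1) ≤ at x (2 * i + 1)) ×
  (∀ j → 1 ≤ j → j ≤ 2 * b ∸ 2 → at x (suc j) ≤ at y j)

Gb : (b n : ℕ) → Graph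
Gb b n = record
  { V   = Σ (Vec ℕ (len b)) (InV b n)
  ; Adj = λ x y → EdgeDir b (Data.Product.proj₁ x) (Data.Product.proj₁ y)
                ⊎ EdgeDir b (Data.Product.proj₁ y) (Data.Product.proj₁ x)
  }
  where import Data.Product

-- Write x_j, y_j (j = 0, 1, …) for the elements of X, Y in increasing order and
-- c_i = 𝟏(B₁ ⋯ B_i).  The homomorphism sends X to
--   (x_{c₀}, x_{c₁-1}, x_{c₁}, x_{c₂-1}, x_{c₂}, …, x_{c_{b-1}}).
-- A primary irreducible type has no proper nonempty prefix with as many ones as
-- twos, and since it starts with a one, every such prefix has more ones than
-- twos; so τ(X,Y) = τ forces x_j < y_j and x_{j+1} ≤ y_j.  By the defining
-- property of the blocks, y_{c_i} sits right after exactly c_{i+1} elements of X,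
-- which gives y_{c_i} ≤ x_{c_{i+1}} and x_{c_{i+1}-1} ≤ y_{c_i}.  These are the
-- inequalities defining G_{b-1}(n).  Secondary types are handled by exchanging
-- the roles of X and Y, which does not change the type-graph.
module Submission where

open import Defs
open import Data.Bool using (Bool; true; false)
open import Data.Fin.Subset using (Subset; ∣_∣)
open import Data.List using (List; []; _∷_; _++_; map; length)
open import Data.List.Properties
  using (++-assoc; ++-identityʳ; ++-conicalʳ; ∷-injectiveˡ; length-++; map-++; length-map; map-∘; map-cong; map-id)
open import Data.List.Relation.Unary.All using (All; []; _∷_)
open import Data.Nat using (ℕ; zero; suc; _+_; _*_; _∸_; _≤_; _<_; z≤n; s≤s; pred; >-nonZero)
open import Data.Nat.Properties
open import Data.Product using (Σ; ∃-syntax; _×_; _,_; proj₂)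
open import Data.Sum using (_⊎_; inj₁; inj₂)
open import Data.Vec using (Vec; []; _∷_; toList)
open import Function using (_∘_; id)
open import Relation.Binary.PropositionalEquality
open import Relation.Nullary using (¬_; contradiction)

-- select xs j is the 1-based position of the j-th (counting from 0) true entry
-- of xs; when there are at most j of them it is length xs + 1.
select : List Bool → ℕ → ℕ
select []           j       = 1
select (true  ∷ xs) zero    = 1
select (true  ∷ xs) (suc j) = suc (select xs j)
select (false ∷ xs) j       = suc (select xs j)

0<select : ∀ xs j → 0 < select xs j
0<select []           j       = s≤s z≤n
0<select (true  ∷ xs) zero    = s≤s z≤n
0<select (true  ∷ xs) (suc j) = s≤s z≤n
0<select (false ∷ xs) j       = s≤s z≤n

select≮1 : ∀ xs j → ¬ select xs j < 1
select≮1 xs j (s≤s select≤0) = <⇒≱ (0<select xs j) select≤0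

select-mono-≤ : ∀ xs {j j′} → j ≤ j′ → select xs j ≤ select xs j′
select-mono-≤ []           _           = ≤-refl
select-mono-≤ (true  ∷ xs) {zero} _    = 0<select (true ∷ xs) _
select-mono-≤ (true  ∷ xs) (s≤s j≤j′) = s≤s (select-mono-≤ xs j≤j′)
select-mono-≤ (false ∷ xs) j≤j′       = s≤s (select-mono-≤ xs j≤j′)

elemAt : ∀ {n} → Subset n → ℕ → ℕ
elemAt X = select (toList X)

elemAt-mono-< : ∀ {n} (X : Subset n) {j j′} → j < j′ → j < ∣ X ∣ → elemAt X j < elemAt X j′
elemAt-mono-< (true  ∷ X) {zero}  {suc j′} _ _ = s≤s (0<select (toList X) j′)
elemAt-mono-< (true  ∷ X) {suc j} (s≤s j<j′) (s≤s j<∣X∣) = s≤s (elemAt-mono-< X j<j′ j<∣X∣)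
elemAt-mono-< (false ∷ X) j<j′ j<∣X∣ = s≤s (elemAt-mono-< X j<j′ j<∣X∣)

elemAt-≤ : ∀ {n} (X : Subset n) {j} → j < ∣ X ∣ → elemAt X j ≤ n
elemAt-≤ (true  ∷ X) {zero}  _           = s≤s z≤n
elemAt-≤ (true  ∷ X) {suc j} (s≤s j<∣X∣) = s≤s (elemAt-≤ X j<∣X∣)
elemAt-≤ (false ∷ X) j<∣X∣               = s≤s (elemAt-≤ X j<∣X∣)

inX : Entry → Bool
inX one   = true
inX two   = false
inX three = true

-- For τ = τ(X,Y), posX τ j is the position of x_j within X ∪ Y, and posY τ j that of y_j.
posX posY : Type → ℕ → ℕ
posX τ = select (map inX τ)
posY τ = posX (map swapE τ)

swapE-involutive : ∀ e → swapE (swapE e) ≡ e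
swapE-involutive one   = refl
swapE-involutive two   = refl
swapE-involutive three = refl

map-swapE-involutive : ∀ τ → map swapE (map swapE τ) ≡ τ
map-swapE-involutive τ = trans (sym (map-∘ τ)) (trans (map-cong swapE-involutive τ) (map-id τ))

posY-swap : ∀ τ j → posY (map swapE τ) j ≡ posX τ j
posY-swap τ j = cong (λ σ → posX σ j) (map-swapE-involutive τ)

orderType-flip : ∀ {n} (X Y : Subset n) → orderType Y X ≡ map swapE (orderType X Y)
orderType-flip []          []          = refl
orderType-flip (true  ∷ X) (true  ∷ Y) = cong (three ∷_) (orderType-flip X Y)
orderType-flip (true  ∷ X) (false ∷ Y) = cong (two ∷_) (orderType-flip X Y)
orderType-flip (false ∷ X) (true  ∷ Y) = cong (one ∷_) (orderType-flip X Y)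
orderType-flip (false ∷ X) (false ∷ Y) = orderType-flip X Y

type⇒elemAt-≤ : ∀ {n σ} (X Y : Subset n) j j′ → orderType X Y ≡ σ →
                posX σ j ≤ posY σ j′ → elemAt X j ≤ elemAt Y j′
type⇒elemAt-≤ []          []          j       j′       refl _ = ≤-refl
type⇒elemAt-≤ (true  ∷ X) (true  ∷ Y) zero    j′       refl _ = 0<select (true ∷ toList Y) j′
type⇒elemAt-≤ (true  ∷ X) (true  ∷ Y) (suc j) zero     refl h = contradiction h (select≮1 _ j)
type⇒elemAt-≤ (true  ∷ X) (true  ∷ Y) (suc j) (suc j′) refl h = s≤s (type⇒elemAt-≤ X Y j j′ refl (≤-pred h))
type⇒elemAt-≤ (true  ∷ X) (false ∷ Y) zero    j′       refl _ = s≤s z≤n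
type⇒elemAt-≤ (true  ∷ X) (false ∷ Y) (suc j) j′       refl h = s≤s (type⇒elemAt-≤ X Y j j′ refl (≤-pred h))
type⇒elemAt-≤ (false ∷ X) (true  ∷ Y) j       zero     refl h = contradiction h (select≮1 _ j)
type⇒elemAt-≤ (false ∷ X) (true  ∷ Y) j       (suc j′) refl h = s≤s (type⇒elemAt-≤ X Y j j′ refl (≤-pred h))
type⇒elemAt-≤ (false ∷ X) (false ∷ Y) j       j′       refl h = s≤s (type⇒elemAt-≤ X Y j j′ refl h)

type⇒elemAt-< : ∀ {n σ} (X Y : Subset n) j j′ → orderType X Y ≡ σ →
                posX σ j < posY σ j′ → elemAt X j < elemAt Y j′
type⇒elemAt-< []          []          j       j′       refl (s≤s ())
type⇒elemAt-< (true  ∷ X) (true  ∷ Y) zero    zero     refl (s≤s ())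
type⇒elemAt-< (true  ∷ X) (true  ∷ Y) zero    (suc j′) refl _ = s≤s (0<select (toList Y) j′)
type⇒elemAt-< (true  ∷ X) (true  ∷ Y) (suc j) zero     refl h = contradiction (<⇒≤ h) (select≮1 _ j)
type⇒elemAt-< (true  ∷ X) (true  ∷ Y) (suc j) (suc j′) refl h = s≤s (type⇒elemAt-< X Y j j′ refl (≤-pred h))
type⇒elemAt-< (true  ∷ X) (false ∷ Y) zero    j′       refl _ = s≤s (0<select (toList Y) j′)
type⇒elemAt-< (true  ∷ X) (false ∷ Y) (suc j) j′       refl h = s≤s (type⇒elemAt-< X Y j j′ refl (≤-pred h))
type⇒elemAt-< (false ∷ X) (true  ∷ Y) j       zero     refl h = contradiction (<⇒≤ h) (select≮1 _ j)
type⇒elemAt-< (false ∷ X) (true  ∷ Y) j       (suc j′) refl h = s≤s (type⇒elemAt-< X Y j j′ refl (≤-pred h))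
type⇒elemAt-< (false ∷ X) (false ∷ Y) j       j′       refl h = s≤s (type⇒elemAt-< X Y j j′ refl h)

type⇒elemAt-≥ : ∀ {n σ} (X Y : Subset n) j j′ → orderType X Y ≡ σ →
                posY σ j′ ≤ posX σ j → elemAt Y j′ ≤ elemAt X j
type⇒elemAt-≥ X Y j j′ refl h =
  type⇒elemAt-≤ Y X j′ j (orderType-flip X Y) (subst (_ ≤_) (sym (posY-swap (orderType X Y) j)) h)

ones-++ : ∀ σ ρ → ones (σ ++ ρ) ≡ ones σ + ones ρ
ones-++ []          ρ = refl
ones-++ (one   ∷ σ) ρ = cong suc (ones-++ σ ρ)
ones-++ (two   ∷ σ) ρ = ones-++ σ ρ
ones-++ (three ∷ σ) ρ = cong suc (ones-++ σ ρ)

twos-++ : ∀ σ ρ → twos (σ ++ ρ) ≡ twos σ + twos ρ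
twos-++ []          ρ = refl
twos-++ (one   ∷ σ) ρ = twos-++ σ ρ
twos-++ (two   ∷ σ) ρ = cong suc (twos-++ σ ρ)
twos-++ (three ∷ σ) ρ = cong suc (twos-++ σ ρ)

twos-∷ : ∀ {e} ρ → e ≢ one → twos (e ∷ ρ) ≡ suc (twos ρ)
twos-∷ {one}   ρ e≢one = contradiction refl e≢one
twos-∷ {two}   ρ _     = refl
twos-∷ {three} ρ _     = refl

twos-allOne : ∀ {B} → All (_≡ one) B → twos B ≡ 0
twos-allOne []         = refl
twos-allOne (refl ∷ B) = twos-allOne B

posX-++-≤ : ∀ π ρ {j} → j < ones π → posX (π ++ ρ) j ≤ length π
posX-++-≤ []          ρ ()
posX-++-≤ (one   ∷ π) ρ {zero}  _         = s≤s z≤n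
posX-++-≤ (one   ∷ π) ρ {suc j} (s≤s j<) = s≤s (posX-++-≤ π ρ j<)
posX-++-≤ (two   ∷ π) ρ j<               = s≤s (posX-++-≤ π ρ j<)
posX-++-≤ (three ∷ π) ρ {zero}  _         = s≤s z≤n
posX-++-≤ (three ∷ π) ρ {suc j} (s≤s j<) = s≤s (posX-++-≤ π ρ j<)

posX-++-> : ∀ π ρ {j} → ones π ≤ j → length π < posX (π ++ ρ) j
posX-++-> []          ρ {j}   _         = 0<select (map inX ρ) j
posX-++-> (one   ∷ π) ρ {suc j} (s≤s ≤j) = s≤s (posX-++-> π ρ ≤j)
posX-++-> (two   ∷ π) ρ ≤j               = s≤s (posX-++-> π ρ ≤j)
posX-++-> (three ∷ π) ρ {suc j} (s≤s ≤j) = s≤s (posX-++-> π ρ ≤j)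

posY-++-∷ : ∀ π {e} ρ → e ≢ one → posY (π ++ e ∷ ρ) (twos π) ≡ suc (length π)
posY-++-∷ []          {one}   ρ e≢one = contradiction refl e≢one
posY-++-∷ []          {two}   ρ _     = refl
posY-++-∷ []          {three} ρ _     = refl
posY-++-∷ (one   ∷ π) ρ e≢one = cong suc (posY-++-∷ π ρ e≢one)
posY-++-∷ (two   ∷ π) ρ e≢one = cong suc (posY-++-∷ π ρ e≢one)
posY-++-∷ (three ∷ π) ρ e≢one = cong suc (posY-++-∷ π ρ e≢one)

record YEntryAfter (τ : Type) (a j : ℕ) : Set where
  constructor cut
  field
    prefix      : Type
    entry       : Entry
    suffix      : Type
    split       : τ ≡ prefix ++ entry ∷ suffix
    entry≢one   : entry ≢ one
    ones-prefix : ones prefix ≡ a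
    twos-prefix : twos prefix ≡ j

  posY≡ : posY τ j ≡ suc (length prefix)
  posY≡ = trans (cong₂ posY split (sym twos-prefix)) (posY-++-∷ prefix suffix entry≢one)

  posX<posY : ∀ {a′} → a′ < a → posX τ a′ < posY τ j
  posX<posY {a′} a′<a = begin-strict
    posX τ a′                          ≡⟨ cong (λ σ → posX σ a′) split ⟩
    posX (prefix ++ entry ∷ suffix) a′ ≤⟨ posX-++-≤ prefix _ (subst (a′ <_) (sym ones-prefix) a′<a) ⟩
    length prefix                      <⟨ n<1+n _ ⟩
    suc (length prefix)                ≡⟨ posY≡ ⟨
    posY τ j                           ∎
    where open ≤-Reasoning

  posY≤posX : ∀ {a′} → a ≤ a′ → posY τ j ≤ posX τ a′
  posY≤posX {a′} a≤a′ = begin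
    posY τ j                           ≡⟨ posY≡ ⟩
    suc (length prefix)                ≤⟨ posX-++-> prefix _ (subst (_≤ a′) (sym ones-prefix) a≤a′) ⟩
    posX (prefix ++ entry ∷ suffix) a′ ≡⟨ cong (λ σ → posX σ a′) split ⟨
    posX τ a′                          ∎
    where open ≤-Reasoning

  j<twos : j < twos τ
  j<twos = begin-strict
    j                                    ≡⟨ twos-prefix ⟨
    twos prefix                          <⟨ m<m+n _ (subst (0 <_) (sym (twos-∷ suffix entry≢one)) (s≤s z≤n)) ⟩
    twos prefix + twos (entry ∷ suffix)  ≡⟨ twos-++ prefix _ ⟨
    twos (prefix ++ entry ∷ suffix)      ≡⟨ cong twos split ⟨
    twos τ                               ∎
    where open ≤-Reasoning

locateY : ∀ τ {j} → j < twos τ → ∃[ a ] YEntryAfter τ a j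
locateY []          ()
locateY (one   ∷ τ) j< with locateY τ j<
... | _ , cut π e ρ split e≢one refl refl = _ , cut (one ∷ π) e ρ (cong (one ∷_) split) e≢one refl refl
locateY (two   ∷ τ) {zero} _ = _ , cut [] two τ refl (λ ()) refl refl
locateY (two   ∷ τ) {suc j} (s≤s j<) with locateY τ j<
... | _ , cut π e ρ split e≢one refl refl = _ , cut (two ∷ π) e ρ (cong (two ∷_) split) e≢one refl refl
locateY (three ∷ τ) {zero} _ = _ , cut [] three τ refl (λ ()) refl refl
locateY (three ∷ τ) {suc j} (s≤s j<) with locateY τ j<
... | _ , cut π e ρ split e≢one refl refl = _ , cut (three ∷ π) e ρ (cong (three ∷_) split) e≢one refl refl

NoBalancedPrefix : Type → Set
NoBalancedPrefix τ = ∀ σ ρ → σ ≢ [] → ρ ≢ [] → τ ≡ σ ++ ρ → ones σ ≢ twos σ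

balanced-suffix : ∀ σ ρ → ones (σ ++ ρ) ≡ twos (σ ++ ρ) → ones σ ≡ twos σ → ones ρ ≡ twos ρ
balanced-suffix σ ρ balanced-σρ balanced-σ = +-cancelˡ-≡ (ones σ) _ _ (begin
  ones σ + ones ρ  ≡⟨ ones-++ σ ρ ⟨
  ones (σ ++ ρ)    ≡⟨ balanced-σρ ⟩
  twos (σ ++ ρ)    ≡⟨ twos-++ σ ρ ⟩
  twos σ + twos ρ  ≡⟨ cong (_+ twos ρ) balanced-σ ⟨
  ones σ + twos ρ  ∎)
  where open ≡-Reasoning

irreducible⇒noBalancedPrefix : ∀ {k τ} → IsTypeOfWidth k τ → Irreducible τ → NoBalancedPrefix τ
irreducible⇒noBalancedPrefix (ones≡k , twos≡k) (_ , _ , irreducible) σ ρ σ≢[] ρ≢[] split balanced-σ =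
  irreducible (σ , ρ , (_ , refl , sym balanced-σ) , (_ , refl , sym balanced-ρ) , σ≢[] , ρ≢[] , split)
  where
  balanced-ρ : ones ρ ≡ twos ρ
  balanced-ρ = balanced-suffix σ ρ
    (subst (λ υ → ones υ ≡ twos υ) split (trans ones≡k (sym twos≡k))) balanced-σ

snoc-twos≤ones : ∀ α e → twos α < ones α → twos (α ++ e ∷ []) ≤ ones (α ++ e ∷ [])
snoc-twos≤ones α e twos<ones rewrite ones-++ α (e ∷ []) | twos-++ α (e ∷ []) with e
... | one   = +-mono-≤ (<⇒≤ twos<ones) z≤n
... | two   = subst₂ _≤_ (+-comm 1 (twos α)) (sym (+-identityʳ (ones α))) twos<ones
... | three = +-monoˡ-≤ 1 (<⇒≤ twos<ones)

module _ {τ : Type} (noBal : NoBalancedPrefix τ) where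

  twos<ones-extend : ∀ α σ ρ → ρ ≢ [] → τ ≡ α ++ σ ++ ρ →
                     twos α < ones α → twos (α ++ σ) < ones (α ++ σ)
  twos<ones-extend α []      ρ _     _     twos<ones =
    subst (λ β → twos β < ones β) (sym (++-identityʳ α)) twos<ones
  twos<ones-extend α (e ∷ σ) ρ ρ≢[] split twos<ones =
    subst (λ β → twos β < ones β) (++-assoc α (e ∷ []) σ)
      (twos<ones-extend (α ++ e ∷ []) σ ρ ρ≢[] split′ twos<ones′)
    where
    split′ : τ ≡ (α ++ e ∷ []) ++ σ ++ ρ
    split′ = trans split (sym (++-assoc α (e ∷ []) (σ ++ ρ)))
    twos<ones′ : twos (α ++ e ∷ []) < ones (α ++ e ∷ [])
    twos<ones′ = ≤∧≢⇒< (snoc-twos≤ones α e twos<ones)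
      (≢-sym (noBal _ _ ((λ ()) ∘ ++-conicalʳ α (e ∷ [])) (ρ≢[] ∘ ++-conicalʳ σ ρ) split′))

  proper-prefix-twos<ones : StartsWith one τ → ∀ σ ρ → σ ≢ [] → ρ ≢ [] → τ ≡ σ ++ ρ →
                            twos σ < ones σ
  proper-prefix-twos<ones _        []      _ σ≢[] _    _     = contradiction refl σ≢[]
  proper-prefix-twos<ones (_ , τ≡) (e ∷ σ) ρ _    ρ≢[] split with ∷-injectiveˡ (trans (sym τ≡) split)
  ... | refl = twos<ones-extend (one ∷ []) σ ρ ρ≢[] split (s≤s z≤n)

CutSequence : Type → ℕ → (ℕ → ℕ) → Set
CutSequence τ b c = ∀ i → i < b → YEntryAfter τ (c (suc i)) (c i)

_◂_ : ℕ → (ℕ → ℕ) → ℕ → ℕ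
(a ◂ c) zero    = a
(a ◂ c) (suc i) = c i

cutSequence-◂ : ∀ {τ a b c} → YEntryAfter τ (c 0) a → CutSequence τ b c → CutSequence τ (suc b) (a ◂ c)
cutSequence-◂ first _    zero    _         = first
cutSequence-◂ _     cuts (suc i) (s≤s i<b) = cuts i i<b

-- α is the part of τ already split into blocks, prev its last block.
blocksAfter⇒cutSequence : ∀ {τ prev rest Bs} α → τ ≡ α ++ rest → ¬ StartsWith one rest →
                          twos α + ones prev ≡ ones α → BlocksAfter prev rest Bs →
                          Σ (ℕ → ℕ) λ c → c 0 ≡ twos α × CutSequence τ (length Bs) c
blocksAfter⇒cutSequence α _ _ _ done = (λ _ → twos α) , refl , λ _ ()
blocksAfter⇒cutSequence α _ _ _ (next [] []≢[] _ _ _ _) = contradiction refl []≢[]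
blocksAfter⇒cutSequence {τ} {prev} α split noOne balance
    (next {rest′ = rest′} B@(e ∷ B′) _ rest≡ twos-B maximal blocks) =
  let c , c₀≡ , cuts = blocksAfter⇒cutSequence (α ++ B) split′ noOne′ balance′ blocks
  in twos α ◂ c , refl , cutSequence-◂ (subst (λ m → YEntryAfter τ m (twos α)) (sym c₀≡) cut-α) cuts
  where
  open ≡-Reasoning
  split′ : τ ≡ (α ++ B) ++ rest′
  split′ = trans split (trans (cong (α ++_) rest≡) (sym (++-assoc α B rest′)))
  noOne′ : ¬ StartsWith one rest′
  noOne′ (_ , rest′≡) = maximal (one ∷ []) _ (λ ()) rest′≡
    (trans (twos-++ B (one ∷ [])) (trans (+-identityʳ (twos B)) twos-B))
  twos-αB : twos (α ++ B) ≡ ones α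
  twos-αB = begin
    twos (α ++ B)        ≡⟨ twos-++ α B ⟩
    twos α + twos B      ≡⟨ cong (twos α +_) twos-B ⟩
    twos α + ones prev   ≡⟨ balance ⟩
    ones α               ∎
  balance′ : twos (α ++ B) + ones B ≡ ones (α ++ B)
  balance′ = trans (cong (_+ ones B) twos-αB) (sym (ones-++ α B))
  e≢one : e ≢ one
  e≢one refl = noOne (_ , rest≡)
  cut-α : YEntryAfter τ (twos (α ++ B)) (twos α)
  cut-α = cut α e (B′ ++ rest′) (trans split (cong (α ++_) rest≡)) e≢one (sym twos-αB) refl

primaryBlockDecomposition⇒cutSequence : ∀ {τ B₁ Bs} → PrimaryBlockDecomposition τ (B₁ ∷ Bs) →
                                        ∃[ c ] CutSequence τ (length Bs) c
primaryBlockDecomposition⇒cutSequence {B₁ = B₁} (_ , _ , allOne , split , noOne , blocks) =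
  let c , _ , cuts = blocksAfter⇒cutSequence B₁ split noOne (cong (_+ ones B₁) (twos-allOne allOne)) blocks
  in c , cuts

fromSeq : (m : ℕ) → (ℕ → ℕ) → Vec ℕ m
fromSeq zero    f = []
fromSeq (suc m) f = f 0 ∷ fromSeq m (f ∘ suc)

at-fromSeq : ∀ m f {j} → j < m → at (fromSeq m f) (suc j) ≡ f j
at-fromSeq (suc m) f {zero}  _         = refl
at-fromSeq (suc m) f {suc j} (s≤s j<m) = at-fromSeq m (f ∘ suc) j<m

interleave : (ℕ → ℕ) → (ℕ → ℕ) → ℕ → ℕ
interleave o e zero    = o 0
interleave o e (suc m) = interleave e (o ∘ suc) m

interleave-even : ∀ o e i → interleave o e (2 * i) ≡ o i
interleave-even o e zero    = refl
interleave-even o e (suc i) = trans (cong (interleave o e) (*-suc 2 i)) (interleave-even (o ∘ suc) (e ∘ suc) i)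

interleave-odd : ∀ o e i → interleave o e (suc (2 * i)) ≡ e i
interleave-odd o e = interleave-even e (o ∘ suc)

len-suc : ∀ b′ → len (suc b′) ≡ suc (2 * b′)
len-suc b′ = cong (_∸ 1) (*-suc 2 b′)

even-or-odd-below : ∀ b′ m → m < 2 * b′ → ∃[ i ] i < b′ × (m ≡ 2 * i ⊎ m ≡ suc (2 * i))
even-or-odd-below (suc b′) zero          _  = 0 , s≤s z≤n , inj₁ refl
even-or-odd-below (suc b′) (suc zero)    _  = 0 , s≤s z≤n , inj₂ refl
even-or-odd-below (suc b′) (suc (suc m)) m<
  with even-or-odd-below b′ m (≤-pred (≤-pred (subst (3 + m ≤_) (*-suc 2 b′) m<)))
... | i , i<b′ , inj₁ refl = suc i , s≤s i<b′ , inj₁ (sym (*-suc 2 i))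
... | i , i<b′ , inj₂ refl = suc i , s≤s i<b′ , inj₂ (cong suc (sym (*-suc 2 i)))

-- vertex b′ o e = (o 0, e 0, o 1, e 1, …, e (b′ - 1), o b′)
vertex : (b′ : ℕ) → (ℕ → ℕ) → (ℕ → ℕ) → Vec ℕ (len (suc b′))
vertex b′ o e = fromSeq (len (suc b′)) (interleave o e)

module VertexAt {b′ : ℕ} (o e : ℕ → ℕ) where

  v : Vec ℕ (len (suc b′))
  v = vertex b′ o e

  at-2i+1 : ∀ {i} → i ≤ b′ → at v (suc (2 * i)) ≡ o i
  at-2i+1 {i} i≤b′ = trans (at-fromSeq _ _ (subst (2 * i <_) (sym (len-suc b′)) (s≤s (*-monoʳ-≤ 2 i≤b′))))
                           (interleave-even o e i)

  at-2i+2 : ∀ {i} → i < b′ → at v (suc (suc (2 * i))) ≡ e i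
  at-2i+2 {i} i<b′ = trans (at-fromSeq _ _ (subst (suc (2 * i) <_) (sym (len-suc b′)) (s≤s (*-monoʳ-< 2 i<b′))))
                           (interleave-odd o e i)

  at-2i+3 : ∀ {i} → i < b′ → at v (suc (suc (suc (2 * i)))) ≡ o (suc i)
  at-2i+3 {i} i<b′ = trans (cong (λ m → at v (suc m)) (sym (*-suc 2 i))) (at-2i+1 i<b′)

  at-2[i+1]-1 : ∀ {i} → i ≤ b′ → at v (2 * suc i ∸ 1) ≡ o i
  at-2[i+1]-1 {i} i≤b′ = trans (cong (at v) (len-suc i)) (at-2i+1 i≤b′)

  at-2[i+1]+1 : ∀ {i} → i < b′ → at v (2 * suc i + 1) ≡ o (suc i)
  at-2[i+1]+1 {i} i<b′ = trans (cong (at v) (+-comm (2 * suc i) 1)) (at-2i+1 i<b′)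

vertex-inV : ∀ {b′ n} o e → 0 < o 0 → o b′ ≤ n →
             (∀ i → i < b′ → o i ≤ e i) → (∀ i → i < b′ → e i ≤ o (suc i)) →
             (∀ i → i < b′ → o i < o (suc i)) →
             InV (suc b′) n (vertex b′ o e)
vertex-inV {b′} {n} o e 0<o₀ oᵦ≤n o≤e e≤o o<o = first , last , ascending , strict
  where
  open VertexAt {b′} o e
  first : 1 ≤ at v 1
  first = subst (1 ≤_) (sym (at-2i+1 z≤n)) 0<o₀
  last : at v (len (suc b′)) ≤ n
  last = subst (_≤ n) (sym (trans (cong (at v) (len-suc b′)) (at-2i+1 ≤-refl))) oᵦ≤n
  ascending : ∀ j → 1 ≤ j → j < len (suc b′) → at v j ≤ at v (suc j)
  ascending (suc m) _ m<len with even-or-odd-below b′ m (≤-pred (subst (2 + m ≤_) (len-suc b′) m<len))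
  ... | i , i<b′ , inj₁ refl = subst₂ _≤_ (sym (at-2i+1 (<⇒≤ i<b′))) (sym (at-2i+2 i<b′)) (o≤e i i<b′)
  ... | i , i<b′ , inj₂ refl = subst₂ _≤_ (sym (at-2i+2 i<b′)) (sym (at-2i+3 i<b′)) (e≤o i i<b′)
  strict : ∀ i → 1 ≤ i → i < suc b′ → at v (2 * i ∸ 1) < at v (2 * i + 1)
  strict (suc i) _ (s≤s i<b′) =
    subst₂ _<_ (sym (at-2[i+1]-1 (<⇒≤ i<b′))) (sym (at-2[i+1]+1 i<b′)) (o<o i i<b′)

vertex-edge : ∀ {b′} o e o′ e′ →
              (∀ i → i ≤ b′ → o i < o′ i) → (∀ i → i < b′ → o′ i ≤ o (suc i)) →
              (∀ i → i < b′ → e i ≤ o′ i) → (∀ i → i < b′ → o (suc i) ≤ e′ i) →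
              EdgeDir (suc b′) (vertex b′ o e) (vertex b′ o′ e′)
vertex-edge {b′} o e o′ e′ o<o′ o′≤o e≤o′ o≤e′ = cond-i , cond-ii , cond-ii′
  where
  module x = VertexAt {b′} o e
  module y = VertexAt {b′} o′ e′
  cond-i : ∀ i → 1 ≤ i → i ≤ suc b′ → at x.v (2 * i ∸ 1) < at y.v (2 * i ∸ 1)
  cond-i (suc i) _ (s≤s i≤b′) =
    subst₂ _<_ (sym (x.at-2[i+1]-1 i≤b′)) (sym (y.at-2[i+1]-1 i≤b′)) (o<o′ i i≤b′)
  cond-ii : ∀ i → 1 ≤ i → i < suc b′ → at y.v (2 * i ∸ 1) ≤ at x.v (2 * i + 1)
  cond-ii (suc i) _ (s≤s i<b′) =
    subst₂ _≤_ (sym (y.at-2[i+1]-1 (<⇒≤ i<b′))) (sym (x.at-2[i+1]+1 i<b′)) (o′≤o i i<b′)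
  cond-ii′ : ∀ j → 1 ≤ j → j ≤ 2 * suc b′ ∸ 2 → at x.v (suc j) ≤ at y.v j
  cond-ii′ (suc m) _ m< with even-or-odd-below b′ m (subst (suc m ≤_) (cong (_∸ 2) (*-suc 2 b′)) m<)
  ... | i , i<b′ , inj₁ refl = subst₂ _≤_ (sym (x.at-2i+2 i<b′)) (sym (y.at-2i+1 (<⇒≤ i<b′))) (e≤o′ i i<b′)
  ... | i , i<b′ , inj₂ refl = subst₂ _≤_ (sym (x.at-2i+3 i<b′)) (sym (y.at-2i+2 i<b′)) (o≤e′ i i<b′)

suc-pred-< : ∀ {m n} → m < n → suc (pred n) ≡ n
suc-pred-< m<n = suc-pred _ {{>-nonZero (m<n⇒0<n m<n)}}

module Primary {τ : Type} {k : ℕ} (width : IsTypeOfWidth k τ) (starts : StartsWith one τ)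
               (noBal : NoBalancedPrefix τ) where

  twos<ones : ∀ {a j} → YEntryAfter τ a j → j < a
  twos<ones (cut [] e ρ split e≢one _ _) =
    contradiction (sym (∷-injectiveˡ (trans (sym (proj₂ starts)) split))) e≢one
  twos<ones (cut π@(_ ∷ _) e ρ split _ refl refl) =
    proper-prefix-twos<ones noBal starts π (e ∷ ρ) (λ ()) (λ ()) split

  j<twos-τ : ∀ {j} → j < k → j < twos τ
  j<twos-τ = subst (_ <_) (sym (proj₂ width))

  posX[j]<posY[j] : ∀ {j} → j < k → posX τ j < posY τ j
  posX[j]<posY[j] j<k = let _ , c = locateY τ (j<twos-τ j<k) in YEntryAfter.posX<posY c (twos<ones c)

  posX[1+j]≤posY[j] : ∀ {j} → suc j < k → posX τ (suc j) ≤ posY τ j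
  posX[1+j]≤posY[j] {j} 1+j<k with locateY τ (j<twos-τ (<-trans (n<1+n j) 1+j<k))
  ... | _ , c@(cut π e ρ split e≢one _ twos-π) = begin
    posX τ (suc j)        ≡⟨ cong (λ υ → posX υ (suc j)) split′ ⟩
    posX (σ ++ ρ) (suc j) ≤⟨ posX-++-≤ σ ρ (subst (_< ones σ) twos-σ σ-twos<ones) ⟩
    length σ              ≡⟨ trans (length-++ π) (+-comm (length π) 1) ⟩
    suc (length π)        ≡⟨ YEntryAfter.posY≡ c ⟨
    posY τ j              ∎
    where
    open ≤-Reasoning
    σ : Type
    σ = π ++ e ∷ []
    split′ : τ ≡ σ ++ ρ
    split′ = trans split (sym (++-assoc π (e ∷ []) ρ))
    twos-σ : twos σ ≡ suc j
    twos-σ = trans (twos-++ π (e ∷ [])) (trans (cong₂ _+_ twos-π (twos-∷ [] e≢one)) (+-comm j 1))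
    ρ≢[] : ρ ≢ []
    ρ≢[] ρ≡[] = <-irrefl (begin-equality
      suc j          ≡⟨ twos-σ ⟨
      twos σ         ≡⟨ cong twos (++-identityʳ σ) ⟨
      twos (σ ++ []) ≡⟨ cong (λ r → twos (σ ++ r)) ρ≡[] ⟨
      twos (σ ++ ρ)  ≡⟨ cong twos split′ ⟨
      twos τ         ≡⟨ proj₂ width ⟩
      k              ∎) 1+j<k
    σ-twos<ones : twos σ < ones σ
    σ-twos<ones = proper-prefix-twos<ones noBal starts σ ρ ((λ ()) ∘ ++-conicalʳ π (e ∷ [])) ρ≢[] split′

  module _ {b′ : ℕ} {c : ℕ → ℕ} (cuts : CutSequence τ (suc b′) c) where

    c<k : ∀ {i} → i ≤ b′ → c i < k
    c<k i≤b′ = subst (_ <_) (proj₂ width) (YEntryAfter.j<twos (cuts _ (s≤s i≤b′)))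

    c-increasing : ∀ {i} → i ≤ b′ → c i < c (suc i)
    c-increasing i≤b′ = twos<ones (cuts _ (s≤s i≤b′))

    x[cᵢ]<y[cᵢ] : ∀ {i} → i ≤ b′ → posX τ (c i) < posY τ (c i)
    x[cᵢ]<y[cᵢ] i≤b′ = posX[j]<posY[j] (c<k i≤b′)

    y[cᵢ]≤x[cᵢ₊₁] : ∀ {i} → i < b′ → posY τ (c i) ≤ posX τ (c (suc i))
    y[cᵢ]≤x[cᵢ₊₁] i<b′ = YEntryAfter.posY≤posX (cuts _ (s≤s (<⇒≤ i<b′))) ≤-refl

    x[cᵢ₊₁-1]≤y[cᵢ] : ∀ {i} → i < b′ → posX τ (pred (c (suc i))) ≤ posY τ (c i)
    x[cᵢ₊₁-1]≤y[cᵢ] i<b′ = <⇒≤ (YEntryAfter.posX<posY (cuts _ (s≤s (<⇒≤ i<b′)))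
                                  (≤-reflexive (suc-pred-< (c-increasing (<⇒≤ i<b′)))))

    x[cᵢ₊₁]≤y[cᵢ₊₁-1] : ∀ {i} → i < b′ → posX τ (c (suc i)) ≤ posY τ (pred (c (suc i)))
    x[cᵢ₊₁]≤y[cᵢ₊₁-1] {i} i<b′ =
      subst (λ m → posX τ m ≤ posY τ (pred (c (suc i)))) suc-pred-cᵢ₊₁
        (posX[1+j]≤posY[j] (subst (_< k) (sym suc-pred-cᵢ₊₁) (c<k i<b′)))
      where
      suc-pred-cᵢ₊₁ : suc (pred (c (suc i))) ≡ c (suc i)
      suc-pred-cᵢ₊₁ = suc-pred-< (c-increasing (<⇒≤ i<b′))

    φ : ∀ {n} → Subset n → Vec ℕ (len (suc b′))
    φ X = vertex b′ (λ i → elemAt X (c i)) (λ i → elemAt X (pred (c (suc i))))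

    φ-inV : ∀ {n} (X : Subset n) → ∣ X ∣ ≡ k → InV (suc b′) n (φ X)
    φ-inV X ∣X∣≡k = vertex-inV _ _
      (0<select (toList X) (c 0))
      (elemAt-≤ X (c<∣X∣ ≤-refl))
      (λ _ i<b′ → select-mono-≤ (toList X) (<⇒≤pred (c-increasing (<⇒≤ i<b′))))
      (λ _ _ → select-mono-≤ (toList X) pred[n]≤n)
      (λ _ i<b′ → elemAt-mono-< X (c-increasing (<⇒≤ i<b′)) (c<∣X∣ (<⇒≤ i<b′)))
      where
      c<∣X∣ : ∀ {i} → i ≤ b′ → c i < ∣ X ∣
      c<∣X∣ i≤b′ = subst (_ <_) (sym ∣X∣≡k) (c<k i≤b′)

    φ-edge : ∀ {n} (X Y : Subset n) → orderType X Y ≡ τ → EdgeDir (suc b′) (φ X) (φ Y)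
    φ-edge X Y type≡τ = vertex-edge _ _ _ _
      (λ _ i≤b′ → type⇒elemAt-< X Y _ _ type≡τ (x[cᵢ]<y[cᵢ] i≤b′))
      (λ _ i<b′ → type⇒elemAt-≥ X Y _ _ type≡τ (y[cᵢ]≤x[cᵢ₊₁] i<b′))
      (λ _ i<b′ → type⇒elemAt-≤ X Y _ _ type≡τ (x[cᵢ₊₁-1]≤y[cᵢ] i<b′))
      (λ _ i<b′ → type⇒elemAt-≤ X Y _ _ type≡τ (x[cᵢ₊₁]≤y[cᵢ₊₁-1] i<b′))

    hom : ∀ n → Hom (typeGraph n k τ) (Gb (suc b′) n)
    hom n = (λ (X , ∣X∣≡k) → φ X , φ-inV X ∣X∣≡k) , λ where
      (X , _) (Y , _) (inj₁ type≡τ) → inj₁ (φ-edge X Y type≡τ)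
      (X , _) (Y , _) (inj₂ type≡τ) → inj₂ (φ-edge Y X type≡τ)

primaryHom : ∀ {τ k Bs} n → IsTypeOfWidth k τ → StartsWith one τ → NoBalancedPrefix τ →
             PrimaryBlockDecomposition τ Bs → 2 ≤ length Bs → Hom (typeGraph n k τ) (Gb (length Bs ∸ 1) n)
primaryHom {Bs = _ ∷ []} _ _ _ _ _ (s≤s ())
primaryHom {Bs = _ ∷ _ ∷ _} n width starts noBal decomposition _ =
  let _ , cuts = primaryBlockDecomposition⇒cutSequence decomposition
  in Primary.hom width starts noBal cuts n

ones-swap : ∀ τ → ones (map swapE τ) ≡ twos τ
ones-swap []          = refl
ones-swap (one   ∷ τ) = ones-swap τ
ones-swap (two   ∷ τ) = cong suc (ones-swap τ)
ones-swap (three ∷ τ) = cong suc (ones-swap τ)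

twos-swap : ∀ τ → twos (map swapE τ) ≡ ones τ
twos-swap []          = refl
twos-swap (one   ∷ τ) = cong suc (twos-swap τ)
twos-swap (two   ∷ τ) = twos-swap τ
twos-swap (three ∷ τ) = cong suc (twos-swap τ)

width-swap : ∀ {k τ} → IsTypeOfWidth k τ → IsTypeOfWidth k (map swapE τ)
width-swap {τ = τ} (ones≡k , twos≡k) = trans (ones-swap τ) twos≡k , trans (twos-swap τ) ones≡k

map-swapE-≢[] : ∀ {σ} → σ ≢ [] → map swapE σ ≢ []
map-swapE-≢[] {[]}    σ≢[] = contradiction refl σ≢[]
map-swapE-≢[] {_ ∷ _} _    = λ ()

noBalancedPrefix-swap : ∀ {τ} → NoBalancedPrefix τ → NoBalancedPrefix (map swapE τ)
noBalancedPrefix-swap {τ} noBal σ ρ σ≢[] ρ≢[] split balanced =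
  noBal (map swapE σ) (map swapE ρ) (map-swapE-≢[] σ≢[]) (map-swapE-≢[] ρ≢[])
    (trans (sym (map-swapE-involutive τ)) (trans (cong (map swapE) split) (map-++ swapE σ ρ)))
    (trans (ones-swap σ) (trans (sym balanced) (sym (twos-swap σ))))

typeGraph-swap : ∀ n k τ → Hom (typeGraph n k τ) (typeGraph n k (map swapE τ))
typeGraph-swap n k τ = id , λ where
  (X , _) (Y , _) (inj₁ type≡τ) → inj₂ (trans (orderType-flip X Y) (cong (map swapE) type≡τ))
  (X , _) (Y , _) (inj₂ type≡τ) → inj₁ (trans (orderType-flip Y X) (cong (map swapE) type≡τ))

Hom-∘ : ∀ {G H K} → Hom H K → Hom G H → Hom G K
Hom-∘ (ψ , ψ-adj) (φ , φ-adj) = ψ ∘ φ , λ u v uv → ψ-adj _ _ (φ-adj u v uv)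

theorem4p2 : (τ : Type) (k : ℕ) (Bs : List Type) (n : ℕ) →
    IsTypeOfWidth k τ → Nontrivial τ → Irreducible τ →
    BlockDecomposition τ Bs → 2 ≤ length Bs →
    1 ≤ n → k ≤ n →
    Hom (typeGraph n k τ) (Gb (length Bs ∸ 1) n)
theorem4p2 τ k Bs n width _ irreducible (inj₁ ((_ , _ , starts) , decomposition)) 2≤∣Bs∣ _ _ =
  primaryHom n width starts (irreducible⇒noBalancedPrefix width irreducible) decomposition 2≤∣Bs∣
theorem4p2 τ k Bs n width _ irreducible (inj₂ ((_ , _ , (rest , τ≡)) , decomposition)) 2≤∣Bs∣ _ _ =
  Hom-∘ {K = Gb (length Bs ∸ 1) n} swappedHom (typeGraph-swap n k τ)
  where
  swappedHom : Hom (typeGraph n k (map swapE τ)) (Gb (length Bs ∸ 1) n)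
  swappedHom = subst (λ m → Hom (typeGraph n k (map swapE τ)) (Gb (m ∸ 1) n)) (length-map (map swapE) Bs)
    (primaryHom n (width-swap {τ = τ} width) (map swapE rest , cong (map swapE) τ≡)
      (noBalancedPrefix-swap (irreducible⇒noBalancedPrefix width irreducible)) decomposition
      (subst (2 ≤_) (sym (length-map (map swapE) Bs)) 2≤∣Bs∣))
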